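{- For any partition $\lambda$, $$R(\lambda,q)=\sum_{x=(i,j)} q^{i(j-1)}\,R(\lambda_{(x)},q)\,R(\lambda^{(x)},q),$$ where the sum runs over all outside corner cells $x$ of $\lambda$, $x$ lying in row $i$ and column $j$, and where $\lambda_{(x)}=(\lambda_{i+1},\lambda_{i+2},\dots)$ and $\lambda^{(x)}=(\lambda_1-j,\lambda_2-j,\dots,\lambda_{i-1}-j)$.
   Context: For a partition $\lambda$, $R(\lambda,q):=\sum_{\mu\subseteq\lambda}q^{|\mu|}$ is the rank-generating function of the interval $[\varnothing,\lambda]$ in Young's lattice (partitions ordered by containment of Ferrers diagrams); $R(\varnothing,q)=1$. An outside corner cell of $\lambda$ is a cell $x=(i,j)$ (row $i$, column $j$, in English notation) not in the Ferrers diagram of $\lambda$ such that adding $x$ to $\lambda$ gives the Ferrers diagram of a partition. -}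

module Defs where

open import Data.Nat using (ℕ; zero; suc; _+_; _*_; _∸_; _⊔_; _≥_; _<_; _≡ᵇ_; _≤ᵇ_)
open import Data.Bool using (Bool; true; false; _∧_; _∨_)
open import Data.List using (List; []; _∷_; map; foldr; length; drop; take; concatMap; applyUpTo; filterᵇ; replicate; _++_)
open import Data.List.Relation.Unary.All using (All)
open import Data.List.Relation.Unary.Linked using (Linked)
open import Data.Product using (_×_; _,_)
open import Data.Nat.ListAction using (sum)
open import Relation.Binary.PropositionalEquality using (_≡_)

IsPartition : List ℕ → Set
IsPartition λ′ = Linked _≥_ λ′ × All (0 <_) λ′

-- 1-based part lookup: part λ i = λ_i, and 0 when i = 0 or i > ℓ(λ).
part : List ℕ → ℕ → ℕ
part []       _             = 0
part (x ∷ xs) 0             = 0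
part (x ∷ xs) 1             = x
part (x ∷ xs) (suc (suc i)) = part xs (suc i)

maxPart : List ℕ → ℕ
maxPart = foldr _⊔_ 0

-- Polynomials in q with ℕ coefficients: coefficient lists, constant first.

Poly : Set
Poly = List ℕ

coeff : Poly → ℕ → ℕ
coeff []       _       = 0
coeff (a ∷ p)  zero    = a
coeff (a ∷ p)  (suc n) = coeff p n

_≈ₚ_ : Poly → Poly → Set
p ≈ₚ r = ∀ n → coeff p n ≡ coeff r n

infix 4 _≈ₚ_
infixl 6 _⊕_
infixl 7 _⊗_

_⊕_ : Poly → Poly → Poly
[]      ⊕ r       = r
(a ∷ p) ⊕ []      = a ∷ p
(a ∷ p) ⊕ (b ∷ r) = (a + b) ∷ (p ⊕ r)

_⊗_ : Poly → Poly → Poly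
[]      ⊗ r = []
(a ∷ p) ⊗ r = map (a *_) r ⊕ (0 ∷ (p ⊗ r))

shift : ℕ → Poly → Poly
shift k p = replicate k 0 ++ p

qpow : ℕ → Poly
qpow k = shift k (1 ∷ [])

Σₚ : List Poly → Poly
Σₚ = foldr _⊕_ []

-- Rank generating function of [∅, λ] in Young's lattice.
-- A partition μ ⊆ λ is represented by its zero-padded list of length ℓ(λ)
-- (μ ⊆ λ forces ℓ(μ) ≤ ℓ(λ)); this is a bijection.

allLists : ℕ → ℕ → List (List ℕ)
allLists zero    m = [] ∷ []
allLists (suc n) m = concatMap (λ a → map (a ∷_) (allLists n m)) (applyUpTo (λ a → a) (suc m))

weaklyDecr : List ℕ → Bool
weaklyDecr []           = true
weaklyDecr (x ∷ [])     = true
weaklyDecr (x ∷ y ∷ xs) = (y ≤ᵇ x) ∧ weaklyDecr (y ∷ xs)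

pointwiseLeq : List ℕ → List ℕ → Bool
pointwiseLeq []       _        = true
pointwiseLeq (x ∷ xs) []       = false
pointwiseLeq (x ∷ xs) (y ∷ ys) = (x ≤ᵇ y) ∧ pointwiseLeq xs ys

subPartitions : List ℕ → List (List ℕ)
subPartitions λ′ = filterᵇ (λ μ → weaklyDecr μ ∧ pointwiseLeq μ λ′) (allLists (length λ′) (maxPart λ′))

R : List ℕ → Poly
R λ′ = Σₚ (map (λ μ → qpow (sum μ)) (subPartitions λ′))

-- A cell (i,j) (1-based) is an outside corner of λ iff it
-- is not in λ and adding it gives a partition, i.e. j = λ_i + 1 and
-- (i = 1 or j ≤ λ_{i-1}).  All such cells satisfy 1 ≤ i ≤ ℓ(λ)+1 and
-- 1 ≤ j ≤ λ_1 + 1, so we range over that box.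

isOutsideCorner : List ℕ → ℕ → ℕ → Bool
isOutsideCorner λ′ i j = (j ≡ᵇ suc (part λ′ i)) ∧ ((i ≡ᵇ 1) ∨ (j ≤ᵇ part λ′ (i ∸ 1)))

cellBox : List ℕ → List (ℕ × ℕ)
cellBox λ′ = concatMap (λ i → map (λ j → (i , j)) (applyUpTo suc (suc (maxPart λ′))))
                       (applyUpTo suc (suc (length λ′)))

outsideCorners : List ℕ → List (ℕ × ℕ)
outsideCorners λ′ = filterᵇ (λ { (i , j) → isOutsideCorner λ′ i j }) (cellBox λ′)

lowerPart : List ℕ → ℕ → List ℕ
lowerPart λ′ i = drop i λ′

upperPart : List ℕ → ℕ → ℕ → List ℕ
upperPart λ′ i j = map (_∸ j) (take (i ∸ 1) λ′)

cornerSum : List ℕ → Poly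
cornerSum λ′ = Σₚ (map (λ { (i , j) → shift (i * (j ∸ 1)) (R (lowerPart λ′ i) ⊗ R (upperPart λ′ i j)) })
                      (outsideCorners λ′))

-- For μ ⊆ λ let i be the first row in which μ reaches λ, i.e. μ_i = λ_i and
-- μ_k < λ_k for k < i (it exists since λ_{ℓ+1} = 0).  Then x = (i, λ_i + 1) is
-- an outside corner of λ, μ contains the i × λ_i rectangle (weight q^{i(j-1)}),
-- its rows below i form an arbitrary partition inside λ_(x), and its rows above
-- i, with the rectangle removed, form an arbitrary partition inside λ^(x).
--
-- The identity is proved by induction on λ in a form refined by a bound c on
-- the first part of μ, where R≤ c λ counts the μ ⊆ λ with μ₁ ≤ c: removing the
-- first row of λ turns the corner sum of the tail, summed over the possible
-- first parts a of μ, into the corner sum of λ itself.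
module Submission where

open import Algebra.Bundles using (CommutativeMonoid)
open import Data.Bool using (Bool; true; false; _∧_; _∨_; if_then_else_)
open import Data.Bool.Properties using (∧-assoc; ∧-zeroʳ)
open import Data.List using (List; []; _∷_; map; _++_; replicate; length; take; concatMap; applyUpTo; filterᵇ; head)
open import Data.List.Relation.Unary.All using (All; []; _∷_)
import Data.List.Relation.Unary.All as All
open import Data.List.Relation.Unary.Linked using (Linked; _∷_; tail; head′)
open import Data.Maybe using (just)
open import Data.Maybe.Relation.Binary.Connected using (Connected; just; just-nothing)
open import Data.Nat using (ℕ; zero; suc; _+_; _*_; _∸_; _⊔_; _⊓_; _≤_; _<_; _≥_; z≤n; s≤s; _≤ᵇ_; _≡ᵇ_; _≤?_; _<?_)
open import Data.Nat.ListAction using (sum)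
open import Data.Nat.Properties
open import Data.Product using (_×_; _,_)
open import Function using (_∘_)
open import Level using (0ℓ)
open import Relation.Binary.PropositionalEquality
open import Relation.Nullary using (¬_; yes; no)
open import Relation.Nullary.Decidable using (dec-true; dec-false)
import Relation.Binary.Reasoning.Setoid as SetoidReasoning

open import Defs

≤ᵇ-true : ∀ {m n} → m ≤ n → (m ≤ᵇ n) ≡ true
≤ᵇ-true {m} {n} = dec-true (m ≤? n)

≤ᵇ-false : ∀ {m n} → ¬ m ≤ n → (m ≤ᵇ n) ≡ false
≤ᵇ-false {m} {n} = dec-false (m ≤? n)

≤ᵇ-⊓ : ∀ a b x → ((a ≤ᵇ b) ∧ (a ≤ᵇ x)) ≡ (a ≤ᵇ b ⊓ x)
≤ᵇ-⊓ a b x with a ≤? b | a ≤? x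
... | yes a≤b | yes a≤x rewrite ≤ᵇ-true a≤b | ≤ᵇ-true a≤x = sym (≤ᵇ-true (⊓-glb a≤b a≤x))
... | yes a≤b | no  a≰x rewrite ≤ᵇ-true a≤b | ≤ᵇ-false a≰x = sym (≤ᵇ-false (a≰x ∘ m≤n⊓o⇒m≤o b x))
... | no  a≰b | _       rewrite ≤ᵇ-false a≰b = sym (≤ᵇ-false (a≰b ∘ m≤n⊓o⇒m≤n b x))

-- Wrapping _≈ₚ_ in a record lets Agda infer both polynomials from a proof.
infix 4 _≋_
record _≋_ (p r : Poly) : Set where
  constructor ⟪_⟫
  field coeff-≡ : p ≈ₚ r
open _≋_

≋-refl : ∀ {p} → p ≋ p
≋-refl = ⟪ (λ n → refl) ⟫

≋-sym : ∀ {p r} → p ≋ r → r ≋ p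
≋-sym ⟪ e ⟫ = ⟪ (λ n → sym (e n)) ⟫

≋-trans : ∀ {p r s} → p ≋ r → r ≋ s → p ≋ s
≋-trans ⟪ e ⟫ ⟪ f ⟫ = ⟪ (λ n → trans (e n) (f n)) ⟫

≡⇒≋ : ∀ {p r} → p ≡ r → p ≋ r
≡⇒≋ refl = ≋-refl

∷-cong : ∀ {a b p r} → a ≡ b → p ≋ r → a ∷ p ≋ b ∷ r
∷-cong refl ⟪ e ⟫ = ⟪ (λ { zero → refl ; (suc n) → e n }) ⟫

if-cong : ∀ c {p r} → p ≋ r → (if c then p else []) ≋ (if c then r else [])
if-cong true  e = e
if-cong false e = ≋-refl

coeff-⊕ : ∀ p r n → coeff (p ⊕ r) n ≡ coeff p n + coeff r n
coeff-⊕ []      r       n       = refl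
coeff-⊕ (a ∷ p) []      n       = sym (+-identityʳ _)
coeff-⊕ (a ∷ p) (b ∷ r) zero    = refl
coeff-⊕ (a ∷ p) (b ∷ r) (suc n) = coeff-⊕ p r n

⊕-cong : ∀ {p p′ r r′} → p ≋ p′ → r ≋ r′ → p ⊕ r ≋ p′ ⊕ r′
⊕-cong {p} {p′} {r} {r′} ⟪ e ⟫ ⟪ f ⟫ = ⟪ (λ n →
  trans (coeff-⊕ p r n) (trans (cong₂ _+_ (e n) (f n)) (sym (coeff-⊕ p′ r′ n)))) ⟫

⊕-comm : ∀ p r → p ⊕ r ≋ r ⊕ p
⊕-comm p r = ⟪ (λ n →
  trans (coeff-⊕ p r n) (trans (+-comm (coeff p n) _) (sym (coeff-⊕ r p n)))) ⟫

⊕-assoc : ∀ p r s → (p ⊕ r) ⊕ s ≋ p ⊕ (r ⊕ s)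
⊕-assoc p r s = ⟪ (λ n → begin
  coeff ((p ⊕ r) ⊕ s) n             ≡⟨ coeff-⊕ (p ⊕ r) s n ⟩
  coeff (p ⊕ r) n + coeff s n       ≡⟨ cong (_+ coeff s n) (coeff-⊕ p r n) ⟩
  coeff p n + coeff r n + coeff s n ≡⟨ +-assoc (coeff p n) _ _ ⟩
  coeff p n + (coeff r n + coeff s n) ≡⟨ cong (coeff p n +_) (coeff-⊕ r s n) ⟨
  coeff p n + coeff (r ⊕ s) n       ≡⟨ coeff-⊕ p (r ⊕ s) n ⟨
  coeff (p ⊕ (r ⊕ s)) n             ∎) ⟫
  where open ≡-Reasoning

⊕-identityʳ : ∀ p → p ⊕ [] ≋ p
⊕-identityʳ p = ⟪ (λ n → trans (coeff-⊕ p [] n) (+-identityʳ _)) ⟫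

⊕-[]-commutativeMonoid : CommutativeMonoid 0ℓ 0ℓ
⊕-[]-commutativeMonoid = record
  { Carrier = Poly
  ; _≈_ = _≋_
  ; _∙_ = _⊕_
  ; ε = []
  ; isCommutativeMonoid = record
    { isMonoid = record
      { isSemigroup = record
        { isMagma = record
          { isEquivalence = record { refl = ≋-refl ; sym = ≋-sym ; trans = ≋-trans }
          ; ∙-cong = ⊕-cong }
        ; assoc = ⊕-assoc }
      ; identity = (λ p → ≋-refl) , ⊕-identityʳ }
    ; comm = ⊕-comm } }

open import Algebra.Properties.CommutativeSemigroup
  (CommutativeMonoid.commutativeSemigroup ⊕-[]-commutativeMonoid) using (interchange)

module ≋-Reasoning = SetoidReasoning (CommutativeMonoid.setoid ⊕-[]-commutativeMonoid)

coeff-map-* : ∀ a r n → coeff (map (a *_) r) n ≡ a * coeff r n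
coeff-map-* a []      n       = sym (*-zeroʳ a)
coeff-map-* a (b ∷ r) zero    = refl
coeff-map-* a (b ∷ r) (suc n) = coeff-map-* a r n

map-*-cong : ∀ a {r r′} → r ≋ r′ → map (a *_) r ≋ map (a *_) r′
map-*-cong a {r} {r′} ⟪ e ⟫ = ⟪ (λ n →
  trans (coeff-map-* a r n) (trans (cong (a *_) (e n)) (sym (coeff-map-* a r′ n)))) ⟫

map-*-⊕ : ∀ a r s → map (a *_) (r ⊕ s) ≡ map (a *_) r ⊕ map (a *_) s
map-*-⊕ a []      s       = refl
map-*-⊕ a (b ∷ r) []      = refl
map-*-⊕ a (b ∷ r) (c ∷ s) = cong₂ _∷_ (*-distribˡ-+ a b c) (map-*-⊕ a r s)

⊗-congʳ : ∀ p {r r′} → r ≋ r′ → p ⊗ r ≋ p ⊗ r′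
⊗-congʳ []      e = ≋-refl
⊗-congʳ (a ∷ p) e = ⊕-cong (map-*-cong a e) (∷-cong refl (⊗-congʳ p e))

⊗-distribˡ-⊕ : ∀ p r s → p ⊗ (r ⊕ s) ≋ p ⊗ r ⊕ p ⊗ s
⊗-distribˡ-⊕ []      r s = ≋-refl
⊗-distribˡ-⊕ (a ∷ p) r s = begin
  map (a *_) (r ⊕ s) ⊕ (0 ∷ p ⊗ (r ⊕ s))
    ≈⟨ ⊕-cong (≡⇒≋ (map-*-⊕ a r s)) (∷-cong refl (⊗-distribˡ-⊕ p r s)) ⟩
  (map (a *_) r ⊕ map (a *_) s) ⊕ ((0 ∷ p ⊗ r) ⊕ (0 ∷ p ⊗ s))
    ≈⟨ interchange (map (a *_) r) (map (a *_) s) (0 ∷ p ⊗ r) (0 ∷ p ⊗ s) ⟩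
  (map (a *_) r ⊕ (0 ∷ p ⊗ r)) ⊕ (map (a *_) s ⊕ (0 ∷ p ⊗ s)) ∎
  where open ≋-Reasoning

⊗-zeroʳ : ∀ p → p ⊗ [] ≋ []
⊗-zeroʳ p = ⟪ coeff-⊗-[] p ⟫
  where
  coeff-⊗-[] : ∀ p n → coeff (p ⊗ []) n ≡ 0
  coeff-⊗-[] []      n       = refl
  coeff-⊗-[] (a ∷ p) zero    = refl
  coeff-⊗-[] (a ∷ p) (suc n) = coeff-⊗-[] p n

⊗-identityʳ : ∀ p → p ⊗ (1 ∷ []) ≋ p
⊗-identityʳ []      = ≋-refl
⊗-identityʳ (a ∷ p) = ∷-cong (trans (+-identityʳ _) (*-identityʳ a)) (⊗-identityʳ p)

shift-cong : ∀ b {p r} → p ≋ r → shift b p ≋ shift b r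
shift-cong zero    e = e
shift-cong (suc b) e = ∷-cong refl (shift-cong b e)

shift-[] : ∀ b → shift b [] ≋ []
shift-[] b = ⟪ coeff-replicate b ⟫
  where
  coeff-replicate : ∀ b n → coeff (replicate b 0 ++ []) n ≡ 0
  coeff-replicate zero    n       = refl
  coeff-replicate (suc b) zero    = refl
  coeff-replicate (suc b) (suc n) = coeff-replicate b n

shift-⊕ : ∀ b p r → shift b (p ⊕ r) ≡ shift b p ⊕ shift b r
shift-⊕ zero    p r = refl
shift-⊕ (suc b) p r = cong (0 ∷_) (shift-⊕ b p r)

shift-shift : ∀ a b p → shift a (shift b p) ≡ shift (a + b) p
shift-shift zero    b p = refl
shift-shift (suc a) b p = cong (0 ∷_) (shift-shift a b p)

shift-comm : ∀ a b p → shift a (shift b p) ≡ shift b (shift a p)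
shift-comm a b p = begin
  shift a (shift b p) ≡⟨ shift-shift a b p ⟩
  shift (a + b) p     ≡⟨ cong (λ k → shift k p) (+-comm a b) ⟩
  shift (b + a) p     ≡⟨ shift-shift b a p ⟨
  shift b (shift a p) ∎
  where open ≡-Reasoning

⊗-0∷ : ∀ p s → p ⊗ (0 ∷ s) ≋ 0 ∷ (p ⊗ s)
⊗-0∷ []      s = ≋-sym (shift-[] 1)
⊗-0∷ (a ∷ p) s = ∷-cong (trans (+-identityʳ _) (*-zeroʳ a)) (⊕-cong ≋-refl (⊗-0∷ p s))

⊗-shift : ∀ b p r → p ⊗ shift b r ≋ shift b (p ⊗ r)
⊗-shift zero    p r = ≋-refl
⊗-shift (suc b) p r = ≋-trans (⊗-0∷ p (shift b r)) (∷-cong refl (⊗-shift b p r))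

∑ : ℕ → (ℕ → Poly) → Poly
∑ zero    f = []
∑ (suc n) f = f 0 ⊕ ∑ n (f ∘ suc)

∑-cong-< : ∀ n {f g} → (∀ k → k < n → f k ≋ g k) → ∑ n f ≋ ∑ n g
∑-cong-< zero    e = ≋-refl
∑-cong-< (suc n) e = ⊕-cong (e 0 (s≤s z≤n)) (∑-cong-< n (λ k k<n → e (suc k) (s≤s k<n)))

∑-cong : ∀ n {f g} → (∀ k → f k ≋ g k) → ∑ n f ≋ ∑ n g
∑-cong n e = ∑-cong-< n (λ k _ → e k)

∑-[] : ∀ n → ∑ n (λ _ → []) ≡ []
∑-[] zero    = refl
∑-[] (suc n) = ∑-[] n

∑-vanish : ∀ n {f} → (∀ k → k < n → f k ≋ []) → ∑ n f ≋ []
∑-vanish n e = ≋-trans (∑-cong-< n e) (≡⇒≋ (∑-[] n))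

∑-+ : ∀ m n f → ∑ (m + n) f ≋ ∑ m f ⊕ ∑ n (λ k → f (m + k))
∑-+ zero    n f = ≋-refl
∑-+ (suc m) n f = ≋-trans (⊕-cong ≋-refl (∑-+ m n (f ∘ suc))) (≋-sym (⊕-assoc (f 0) _ _))

∑-suc : ∀ n f → ∑ (suc n) f ≋ f n ⊕ ∑ n f
∑-suc n f = begin
  ∑ (suc n) f                  ≡⟨ cong (λ k → ∑ k f) (+-comm 1 n) ⟩
  ∑ (n + 1) f                  ≈⟨ ∑-+ n 1 f ⟩
  ∑ n f ⊕ (f (n + 0) ⊕ [])     ≈⟨ ⊕-comm (∑ n f) _ ⟩
  (f (n + 0) ⊕ []) ⊕ ∑ n f     ≈⟨ ⊕-cong (⊕-identityʳ (f (n + 0))) ≋-refl ⟩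
  f (n + 0) ⊕ ∑ n f            ≡⟨ cong (λ k → f k ⊕ ∑ n f) (+-identityʳ n) ⟩
  f n ⊕ ∑ n f                  ∎
  where open ≋-Reasoning

∑-suc-⊓ : ∀ c x f → ∑ (suc (c ⊓ x)) f ≋ (if x ≤ᵇ c then f x else []) ⊕ ∑ (suc c ⊓ x) f
∑-suc-⊓ c x f with x ≤? c
... | yes x≤c rewrite ≤ᵇ-true x≤c | m≥n⇒m⊓n≡n x≤c | m≥n⇒m⊓n≡n (m≤n⇒m≤1+n x≤c) = ∑-suc x f
... | no  x≰c rewrite ≤ᵇ-false x≰c | m≤n⇒m⊓n≡m (<⇒≤ (≰⇒> x≰c)) | m≤n⇒m⊓n≡m (≰⇒> x≰c) = ≋-refl

∑-distrib-⊕ : ∀ n f g → ∑ n (λ k → f k ⊕ g k) ≋ ∑ n f ⊕ ∑ n g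
∑-distrib-⊕ zero    f g = ≋-refl
∑-distrib-⊕ (suc n) f g = ≋-trans (⊕-cong ≋-refl (∑-distrib-⊕ n (f ∘ suc) (g ∘ suc)))
  (interchange (f 0) (g 0) (∑ n (f ∘ suc)) (∑ n (g ∘ suc)))

∑-comm : ∀ m n (f : ℕ → ℕ → Poly) → ∑ m (λ a → ∑ n (f a)) ≋ ∑ n (λ k → ∑ m (λ a → f a k))
∑-comm zero    n f = ≡⇒≋ (sym (∑-[] n))
∑-comm (suc m) n f = ≋-trans (⊕-cong ≋-refl (∑-comm m n (f ∘ suc)))
  (≋-sym (∑-distrib-⊕ n (f 0) (λ k → ∑ m (λ a → f (suc a) k))))

shift-∑ : ∀ b n f → shift b (∑ n f) ≋ ∑ n (λ k → shift b (f k))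
shift-∑ b zero    f = shift-[] b
shift-∑ b (suc n) f = ≋-trans (≡⇒≋ (shift-⊕ b (f 0) _)) (⊕-cong ≋-refl (shift-∑ b n (f ∘ suc)))

⊗-∑ : ∀ p n f → p ⊗ ∑ n f ≋ ∑ n (λ k → p ⊗ f k)
⊗-∑ p zero    f = ⊗-zeroʳ p
⊗-∑ p (suc n) f = ≋-trans (⊗-distribˡ-⊕ p (f 0) _) (⊕-cong ≋-refl (⊗-∑ p n (f ∘ suc)))

∑-select : ∀ n t (b : ℕ → Bool) (g : ℕ → Poly) → t < n →
  ∑ n (λ k → if (k ≡ᵇ t) ∧ b k then g k else []) ≋ (if b t then g t else [])
∑-select (suc n) zero    b g _         = ≋-trans (⊕-cong ≋-refl (≡⇒≋ (∑-[] n))) (⊕-identityʳ _)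
∑-select (suc n) (suc t) b g (s≤s t<n) = ∑-select n t (b ∘ suc) (g ∘ suc) t<n

∑-truncate : ∀ {t m} → t ≤ m → (g : ℕ → Poly) →
  ∑ (suc m) (λ a → if a ≤ᵇ t then g a else []) ≋ ∑ (suc t) g
∑-truncate {t} {m} t≤m g = begin
  ∑ (suc m) h                                      ≡⟨ cong (λ n → ∑ n h) (cong suc (m+[n∸m]≡n t≤m)) ⟨
  ∑ (suc t + (m ∸ t)) h                            ≈⟨ ∑-+ (suc t) (m ∸ t) h ⟩
  ∑ (suc t) h ⊕ ∑ (m ∸ t) (λ k → h (suc t + k))   ≈⟨ ⊕-cong (∑-cong-< (suc t) kept) (∑-vanish (m ∸ t) dropped) ⟩
  ∑ (suc t) g ⊕ []                                 ≈⟨ ⊕-identityʳ _ ⟩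
  ∑ (suc t) g                                      ∎
  where
  open ≋-Reasoning
  h : ℕ → Poly
  h a = if a ≤ᵇ t then g a else []
  kept : ∀ a → a < suc t → h a ≋ g a
  kept a (s≤s a≤t) rewrite ≤ᵇ-true a≤t = ≋-refl
  dropped : ∀ k → k < m ∸ t → h (suc t + k) ≋ []
  dropped k _ rewrite ≤ᵇ-false (<⇒≱ (s≤s (m≤m+n t k))) = ≋-refl

sumOver : {A : Set} → List A → (A → Poly) → Poly
sumOver xs F = Σₚ (map F xs)

sumOver-filterᵇ : {A : Set} (P : A → Bool) (F : A → Poly) → ∀ xs →
  sumOver (filterᵇ P xs) F ≡ sumOver xs (λ x → if P x then F x else [])
sumOver-filterᵇ P F []       = refl
sumOver-filterᵇ P F (x ∷ xs) with P x
... | true  = cong (F x ⊕_) (sumOver-filterᵇ P F xs)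
... | false = sumOver-filterᵇ P F xs

sumOver-cong : {A : Set} {F G : A → Poly} → ∀ xs → (∀ x → F x ≋ G x) → sumOver xs F ≋ sumOver xs G
sumOver-cong []       e = ≋-refl
sumOver-cong (x ∷ xs) e = ⊕-cong (e x) (sumOver-cong xs e)

sumOver-++ : {A : Set} (F : A → Poly) → ∀ xs ys → sumOver (xs ++ ys) F ≋ sumOver xs F ⊕ sumOver ys F
sumOver-++ F []       ys = ≋-refl
sumOver-++ F (x ∷ xs) ys = ≋-trans (⊕-cong ≋-refl (sumOver-++ F xs ys)) (≋-sym (⊕-assoc (F x) _ _))

sumOver-concatMap : {A B : Set} (F : B → Poly) (h : A → List B) → ∀ xs →
  sumOver (concatMap h xs) F ≋ sumOver xs (λ a → sumOver (h a) F)
sumOver-concatMap F h []       = ≋-refl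
sumOver-concatMap F h (x ∷ xs) =
  ≋-trans (sumOver-++ F (h x) (concatMap h xs)) (⊕-cong ≋-refl (sumOver-concatMap F h xs))

sumOver-map : {A B : Set} (F : B → Poly) (g : A → B) → ∀ xs → sumOver (map g xs) F ≡ sumOver xs (F ∘ g)
sumOver-map F g []       = refl
sumOver-map F g (x ∷ xs) = cong (F (g x) ⊕_) (sumOver-map F g xs)

sumOver-applyUpTo : {A : Set} (F : A → Poly) (g : ℕ → A) → ∀ n → sumOver (applyUpTo g n) F ≡ ∑ n (F ∘ g)
sumOver-applyUpTo F g zero    = refl
sumOver-applyUpTo F g (suc n) = cong (F (g 0) ⊕_) (sumOver-applyUpTo F (g ∘ suc) n)

sumOver-shift : {A : Set} (F : A → Poly) → ∀ b xs → sumOver xs (λ x → shift b (F x)) ≋ shift b (sumOver xs F)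
sumOver-shift F b []       = ≋-sym (shift-[] b)
sumOver-shift F b (x ∷ xs) = ≋-trans (⊕-cong ≋-refl (sumOver-shift F b xs)) (≡⇒≋ (sym (shift-⊕ b (F x) _)))

sumOver-if : {A : Set} (F : A → Poly) → ∀ c xs →
  sumOver xs (λ x → if c then F x else []) ≋ (if c then sumOver xs F else [])
sumOver-if F true  xs       = ≋-refl
sumOver-if F false []       = ≋-refl
sumOver-if F false (x ∷ xs) = sumOver-if F false xs

-- Partitions inside λ with bounded first part

-- R≤ b λ = Σ_{μ ⊆ λ, μ₁ ≤ b} q^{|μ|}, recursing on the first part a of μ.
R≤ : ℕ → List ℕ → Poly
R≤ b []       = 1 ∷ []
R≤ b (x ∷ xs) = ∑ (suc (b ⊓ x)) (λ a → shift a (R≤ a xs))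

HeadAtMost : ℕ → List ℕ → Set
HeadAtMost b xs = Connected _≥_ (just b) (head xs)

R≤-cap : ∀ {b b′} xs → HeadAtMost b xs → HeadAtMost b′ xs → R≤ b xs ≡ R≤ b′ xs
R≤-cap []       _          _           = refl
R≤-cap (x ∷ xs) (just x≤b) (just x≤b′) rewrite m≥n⇒m⊓n≡n x≤b | m≥n⇒m⊓n≡n x≤b′ = refl

headAtMost-maxPart : ∀ xs → HeadAtMost (maxPart xs) xs
headAtMost-maxPart []       = just-nothing
headAtMost-maxPart (x ∷ xs) = just (m≤m⊔n x (maxPart xs))

All-≤-maxPart : ∀ xs → All (_≤ maxPart xs) xs
All-≤-maxPart []       = []
All-≤-maxPart (x ∷ xs) =
  m≤m⊔n x (maxPart xs) ∷ All.map (λ y≤m → ≤-trans y≤m (m≤n⊔m x (maxPart xs))) (All-≤-maxPart xs)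

headAtMostᵇ : ℕ → List ℕ → Bool
headAtMostᵇ b []      = true
headAtMostᵇ b (y ∷ _) = y ≤ᵇ b

weaklyDecr-∷ : ∀ a μ → weaklyDecr (a ∷ μ) ≡ headAtMostᵇ a μ ∧ weaklyDecr μ
weaklyDecr-∷ a []      = refl
weaklyDecr-∷ a (y ∷ μ) = refl

admissibleᵇ : ℕ → List ℕ → List ℕ → Bool
admissibleᵇ b λ′ μ = headAtMostᵇ b μ ∧ (weaklyDecr μ ∧ pointwiseLeq μ λ′)

admissibleᵇ-∷ : ∀ b x xs a μ → admissibleᵇ b (x ∷ xs) (a ∷ μ) ≡ (a ≤ᵇ b ⊓ x) ∧ admissibleᵇ a xs μ
admissibleᵇ-∷ b x xs a μ rewrite weaklyDecr-∷ a μ | sym (≤ᵇ-⊓ a b x) =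
  rearrange (a ≤ᵇ b) (a ≤ᵇ x) (headAtMostᵇ a μ) (weaklyDecr μ) (pointwiseLeq μ xs)
  where
  rearrange : ∀ p q h w l → p ∧ ((h ∧ w) ∧ (q ∧ l)) ≡ (p ∧ q) ∧ (h ∧ (w ∧ l))
  rearrange false q     h w l = refl
  rearrange true  false h w l = ∧-zeroʳ (h ∧ w)
  rearrange true  true  h w l = ∧-assoc h w l

admissibleᵇ-maxPart : ∀ λ′ μ → admissibleᵇ (maxPart λ′) λ′ μ ≡ weaklyDecr μ ∧ pointwiseLeq μ λ′
admissibleᵇ-maxPart λ′       []      = refl
admissibleᵇ-maxPart []       (y ∷ μ) rewrite ∧-zeroʳ (weaklyDecr (y ∷ μ)) = ∧-zeroʳ (y ≤ᵇ 0)
admissibleᵇ-maxPart (x ∷ xs) (y ∷ μ) with y ≤? x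
... | yes y≤x rewrite ≤ᵇ-true (≤-trans y≤x (m≤m⊔n x (maxPart xs))) = refl
... | no  y≰x rewrite ≤ᵇ-false y≰x | ∧-zeroʳ (weaklyDecr (y ∷ μ)) = ∧-zeroʳ (y ≤ᵇ x ⊔ maxPart xs)

-- R≤ b λ computed as R computes R λ, by enumerating {0,…,m}^ℓ(λ).
subPartitionSum : ℕ → ℕ → List ℕ → Poly
subPartitionSum m b λ′ = sumOver (allLists (length λ′) m) (λ μ → if admissibleᵇ b λ′ μ then qpow (sum μ) else [])

sumOver-allLists-suc : ∀ n m (F : List ℕ → Poly) →
  sumOver (allLists (suc n) m) F ≋ ∑ (suc m) (λ a → sumOver (allLists n m) (λ μ → F (a ∷ μ)))
sumOver-allLists-suc n m F =
  ≋-trans (sumOver-concatMap F (λ a → map (a ∷_) (allLists n m)) (applyUpTo (λ a → a) (suc m)))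
  (≋-trans (≡⇒≋ (sumOver-applyUpTo _ (λ a → a) (suc m)))
  (∑-cong (suc m) (λ a → ≡⇒≋ (sumOver-map F (a ∷_) (allLists n m)))))

subPartitionSum-∷ : ∀ m b x xs →
  subPartitionSum m b (x ∷ xs) ≋ ∑ (suc m) (λ a → if a ≤ᵇ b ⊓ x then shift a (subPartitionSum m a xs) else [])
subPartitionSum-∷ m b x xs =
  ≋-trans (sumOver-allLists-suc (length xs) m _) (∑-cong (suc m) (λ a →
  ≋-trans (sumOver-cong (allLists (length xs) m) (firstPart a))
  (≋-trans (sumOver-if _ (a ≤ᵇ b ⊓ x) (allLists (length xs) m))
  (if-cong (a ≤ᵇ b ⊓ x) (sumOver-shift _ a (allLists (length xs) m))))))
  where
  split : ∀ c d a s → (if c ∧ d then qpow (a + s) else []) ≋ (if c then shift a (if d then qpow s else []) else [])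
  split false d     a s = ≋-refl
  split true  false a s = ≋-sym (shift-[] a)
  split true  true  a s = ≡⇒≋ (sym (shift-shift a s (1 ∷ [])))
  firstPart : ∀ a μ →
    (if admissibleᵇ b (x ∷ xs) (a ∷ μ) then qpow (a + sum μ) else [])
    ≋ (if a ≤ᵇ b ⊓ x then shift a (if admissibleᵇ a xs μ then qpow (sum μ) else []) else [])
  firstPart a μ rewrite admissibleᵇ-∷ b x xs a μ = split (a ≤ᵇ b ⊓ x) (admissibleᵇ a xs μ) a (sum μ)

subPartitionSum≋R≤ : ∀ {m} λ′ → All (_≤ m) λ′ → ∀ b → subPartitionSum m b λ′ ≋ R≤ b λ′
subPartitionSum≋R≤         []       _            b = ≋-refl
subPartitionSum≋R≤ {m} (x ∷ xs) (x≤m ∷ xs≤m) b =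
  ≋-trans (subPartitionSum-∷ m b x xs)
  (≋-trans (∑-cong (suc m) (λ a → if-cong (a ≤ᵇ b ⊓ x) (shift-cong a (subPartitionSum≋R≤ xs xs≤m a))))
  (∑-truncate (≤-trans (m⊓n≤n b x) x≤m) (λ a → shift a (R≤ a xs))))

R≋R≤ : ∀ λ′ → R λ′ ≋ R≤ (maxPart λ′) λ′
R≋R≤ λ′ = begin
  R λ′
    ≡⟨ sumOver-filterᵇ _ (λ μ → qpow (sum μ)) (allLists (length λ′) (maxPart λ′)) ⟩
  sumOver (allLists (length λ′) (maxPart λ′)) (λ μ → if weaklyDecr μ ∧ pointwiseLeq μ λ′ then qpow (sum μ) else [])
    ≈⟨ sumOver-cong (allLists (length λ′) (maxPart λ′))
         (λ μ → ≡⇒≋ (cong (λ c → if c then qpow (sum μ) else []) (sym (admissibleᵇ-maxPart λ′ μ)))) ⟩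
  subPartitionSum (maxPart λ′) (maxPart λ′) λ′
    ≈⟨ subPartitionSum≋R≤ λ′ (All-≤-maxPart λ′) (maxPart λ′) ⟩
  R≤ (maxPart λ′) λ′ ∎
  where open ≋-Reasoning

-- The corner decomposition of R≤ c λ

-- Row i carries an outside corner, necessarily the cell (i, λ_i + 1).
cornerRowᵇ : List ℕ → ℕ → Bool
cornerRowᵇ λ′ i = (i ≡ᵇ 1) ∨ (suc (part λ′ i) ≤ᵇ part λ′ (i ∸ 1))

cornerTerm : ℕ → List ℕ → ℕ → Poly
cornerTerm c λ′ i =
  if cornerRowᵇ λ′ i
  then (if part λ′ i ≤ᵇ c
        then shift (i * part λ′ i)
               (R (lowerPart λ′ i) ⊗ R≤ (c ∸ part λ′ i) (upperPart λ′ i (suc (part λ′ i))))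
        else [])
  else []

cornerSum≤ : ℕ → List ℕ → Poly
cornerSum≤ c λ′ = ∑ (suc (length λ′)) (λ k → cornerTerm c λ′ (suc k))

part-≤-head : ∀ {x xs} → Linked _≥_ (x ∷ xs) → ∀ i → part xs i ≤ x
part-≤-head {xs = []}     _        i             = z≤n
part-≤-head {xs = y ∷ ys} _        zero          = z≤n
part-≤-head {xs = y ∷ ys} (y≤x ∷ _) (suc zero)    = y≤x
part-≤-head {xs = y ∷ ys} (y≤x ∷ l) (suc (suc i)) = ≤-trans (part-≤-head l (suc i)) y≤x

cornerRowᵇ-∷ : ∀ {x xs} → Linked _≥_ (x ∷ xs) → ∀ k →
  cornerRowᵇ (x ∷ xs) (suc (suc k)) ≡ cornerRowᵇ xs (suc k) ∧ (suc (part xs (suc k)) ≤ᵇ x)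
cornerRowᵇ-∷ l zero = refl
cornerRowᵇ-∷ {x} {xs} l (suc k) with suc (part xs (suc (suc k))) ≤? part xs (suc k)
... | yes below rewrite ≤ᵇ-true below | ≤ᵇ-true (≤-trans below (part-≤-head l (suc k))) = refl
... | no  ¬below rewrite ≤ᵇ-false ¬below = refl

suc-⊓-split : ∀ {y x c} → y < x → y ≤ c → suc c ⊓ x ≡ y + suc ((c ∸ y) ⊓ (x ∸ suc y))
suc-⊓-split {y} {x} {c} y<x y≤c = begin
  suc c ⊓ x                                   ≡⟨ cong₂ (λ u v → suc u ⊓ v) (m+[n∸m]≡n y≤c) (m+[n∸m]≡n y<x) ⟨
  suc (y + (c ∸ y)) ⊓ suc (y + (x ∸ suc y))   ≡⟨ cong suc (+-distribˡ-⊓ y (c ∸ y) (x ∸ suc y)) ⟨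
  suc (y + ((c ∸ y) ⊓ (x ∸ suc y)))           ≡⟨ +-suc y _ ⟨
  y + suc ((c ∸ y) ⊓ (x ∸ suc y))             ∎
  where open ≡-Reasoning

shift-if-≤ᵇ-below : ∀ {y a} p → a < y → shift a (if y ≤ᵇ a then p else []) ≋ []
shift-if-≤ᵇ-below {y} {a} p a<y rewrite ≤ᵇ-false (<⇒≱ a<y) = shift-[] a

-- Only the a ∈ [y, min(c, x - 1)] contribute; substituting a = y + b leaves a
-- sum of the shape of R≤ (c - y) ((x - y - 1) ∷ _).
∑-window : ∀ y c x (T : ℕ → Poly) →
  ∑ (suc c ⊓ x) (λ a → shift a (if y ≤ᵇ a then T (a ∸ y) else []))
  ≋ (if (suc y ≤ᵇ x) ∧ (y ≤ᵇ c) then shift y (∑ (suc ((c ∸ y) ⊓ (x ∸ suc y))) (λ b → shift b (T b))) else [])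
∑-window y c x T with y <? x | y ≤? c
... | yes y<x | yes y≤c rewrite ≤ᵇ-true y<x | ≤ᵇ-true y≤c = begin
  ∑ (suc c ⊓ x) g                               ≡⟨ cong (λ k → ∑ k g) (suc-⊓-split y<x y≤c) ⟩
  ∑ (y + n) g                                   ≈⟨ ∑-+ y n g ⟩
  ∑ y g ⊕ ∑ n (λ b → g (y + b))                 ≈⟨ ⊕-cong (∑-vanish y (λ a → shift-if-≤ᵇ-below _)) (∑-cong n shifted) ⟩
  [] ⊕ ∑ n (λ b → shift y (shift b (T b)))      ≈⟨ ≋-sym (shift-∑ y n (λ b → shift b (T b))) ⟩
  shift y (∑ n (λ b → shift b (T b)))           ∎
  where
  open ≋-Reasoning
  n : ℕ
  n = suc ((c ∸ y) ⊓ (x ∸ suc y))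
  g : ℕ → Poly
  g a = shift a (if y ≤ᵇ a then T (a ∸ y) else [])
  shifted : ∀ b → g (y + b) ≋ shift y (shift b (T b))
  shifted b rewrite ≤ᵇ-true (m≤m+n y b) | m+n∸m≡n y b = ≡⇒≋ (sym (shift-shift y b (T b)))
... | no y≮x | _ rewrite ≤ᵇ-false y≮x =
  ∑-vanish _ (λ a a<N → shift-if-≤ᵇ-below _ (<-≤-trans a<N (≤-trans (m⊓n≤n (suc c) x) (≮⇒≥ y≮x))))
... | yes y<x | no y≰c rewrite ≤ᵇ-true y<x | ≤ᵇ-false y≰c =
  ∑-vanish _ (λ a a<N → shift-if-≤ᵇ-below _ (<-≤-trans a<N (≤-trans (m⊓n≤m (suc c) x) (≰⇒> y≰c))))

shift-∑-R≤ : ∀ y K A b z U →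
  shift y (∑ (suc (b ⊓ z)) (λ t → shift t (shift K (A ⊗ R≤ t U)))) ≋ shift (y + K) (A ⊗ R≤ b (z ∷ U))
shift-∑-R≤ y K A b z U = begin
  shift y (∑ n (λ t → shift t (shift K (A ⊗ R≤ t U))))
    ≈⟨ shift-cong y (∑-cong n (λ t → ≡⇒≋ (shift-comm t K (A ⊗ R≤ t U)))) ⟩
  shift y (∑ n (λ t → shift K (shift t (A ⊗ R≤ t U))))
    ≈⟨ shift-cong y (≋-sym (shift-∑ K n (λ t → shift t (A ⊗ R≤ t U)))) ⟩
  shift y (shift K (∑ n (λ t → shift t (A ⊗ R≤ t U))))
    ≡⟨ shift-shift y K _ ⟩
  shift (y + K) (∑ n (λ t → shift t (A ⊗ R≤ t U)))
    ≈⟨ shift-cong (y + K) (≋-sym (≋-trans (⊗-∑ A n (λ t → shift t (R≤ t U))) (∑-cong n (λ t → ⊗-shift t A (R≤ t U))))) ⟩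
  shift (y + K) (A ⊗ R≤ b (z ∷ U)) ∎
  where
  open ≋-Reasoning
  n : ℕ
  n = suc (b ⊓ z)

if-∧ : ∀ d e (p : Poly) → (if d ∧ e then p else []) ≡ (if d then (if e then p else []) else [])
if-∧ false e p = refl
if-∧ true  e p = refl

cornerTerm-∷ : ∀ {x xs} → Linked _≥_ (x ∷ xs) → ∀ c k →
  ∑ (suc c ⊓ x) (λ a → shift a (cornerTerm a xs (suc k))) ≋ cornerTerm c (x ∷ xs) (suc (suc k))
cornerTerm-∷ {x} {xs} l c k =
  ≋-trans (byCornerRow (cornerRowᵇ xs (suc k)))
          (≡⇒≋ (cong (λ o → if o then corner else []) (sym (cornerRowᵇ-∷ l k))))
  where
  y K : ℕ
  y = part xs (suc k)
  K = suc k * y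
  A : Poly
  A = R (lowerPart xs (suc k))
  U : List ℕ
  U = upperPart xs (suc k) (suc y)
  corner : Poly
  corner = if y ≤ᵇ c then shift (y + K) (A ⊗ R≤ (c ∸ y) ((x ∸ suc y) ∷ U)) else []
  byCornerRow : ∀ o →
    ∑ (suc c ⊓ x) (λ a → shift a (if o then (if y ≤ᵇ a then shift K (A ⊗ R≤ (a ∸ y) U) else []) else []))
    ≋ (if o ∧ (suc y ≤ᵇ x) then corner else [])
  byCornerRow false = ∑-vanish (suc c ⊓ x) (λ a _ → shift-[] a)
  byCornerRow true  = begin
    ∑ (suc c ⊓ x) (λ a → shift a (if y ≤ᵇ a then shift K (A ⊗ R≤ (a ∸ y) U) else []))
      ≈⟨ ∑-window y c x (λ b → shift K (A ⊗ R≤ b U)) ⟩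
    (if (suc y ≤ᵇ x) ∧ (y ≤ᵇ c) then shift y (∑ n (λ b → shift b (shift K (A ⊗ R≤ b U)))) else [])
      ≡⟨ if-∧ (suc y ≤ᵇ x) (y ≤ᵇ c) _ ⟩
    (if suc y ≤ᵇ x then (if y ≤ᵇ c then shift y (∑ n (λ b → shift b (shift K (A ⊗ R≤ b U)))) else []) else [])
      ≈⟨ if-cong (suc y ≤ᵇ x) (if-cong (y ≤ᵇ c) (shift-∑-R≤ y K A (c ∸ y) (x ∸ suc y) U)) ⟩
    (if suc y ≤ᵇ x then corner else []) ∎
    where
    open ≋-Reasoning
    n : ℕ
    n = suc ((c ∸ y) ⊓ (x ∸ suc y))

R≤≋cornerSum≤ : ∀ λ′ → Linked _≥_ λ′ → ∀ c → R≤ c λ′ ≋ cornerSum≤ c λ′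
R≤≋cornerSum≤ []       _ c = ≋-refl
R≤≋cornerSum≤ (x ∷ xs) l c = begin
  R≤ c (x ∷ xs)                                    ≈⟨ ∑-suc-⊓ c x f ⟩
  (if x ≤ᵇ c then f x else []) ⊕ ∑ (suc c ⊓ x) f   ≈⟨ ⊕-cong (if-cong (x ≤ᵇ c) firstRow) otherRows ⟩
  cornerSum≤ c (x ∷ xs)                            ∎
  where
  open ≋-Reasoning
  ℓ N : ℕ
  ℓ = length xs
  N = suc c ⊓ x
  f : ℕ → Poly
  f a = shift a (R≤ a xs)
  firstRow : f x ≋ shift (1 * x) (R xs ⊗ (1 ∷ []))
  firstRow rewrite *-identityˡ x = shift-cong x (begin
    R≤ x xs             ≡⟨ R≤-cap xs (head′ l) (headAtMost-maxPart xs) ⟩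
    R≤ (maxPart xs) xs  ≈⟨ ≋-sym (R≋R≤ xs) ⟩
    R xs                ≈⟨ ≋-sym (⊗-identityʳ (R xs)) ⟩
    R xs ⊗ (1 ∷ [])     ∎)
  otherRows : ∑ N f ≋ ∑ (suc ℓ) (λ k → cornerTerm c (x ∷ xs) (suc (suc k)))
  otherRows = begin
    ∑ N f
      ≈⟨ ∑-cong N (λ a → shift-cong a (R≤≋cornerSum≤ xs (tail l) a)) ⟩
    ∑ N (λ a → shift a (cornerSum≤ a xs))
      ≈⟨ ∑-cong N (λ a → shift-∑ a (suc ℓ) (λ k → cornerTerm a xs (suc k))) ⟩
    ∑ N (λ a → ∑ (suc ℓ) (λ k → shift a (cornerTerm a xs (suc k))))
      ≈⟨ ∑-comm N (suc ℓ) (λ a k → shift a (cornerTerm a xs (suc k))) ⟩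
    ∑ (suc ℓ) (λ k → ∑ N (λ a → shift a (cornerTerm a xs (suc k))))
      ≈⟨ ∑-cong (suc ℓ) (cornerTerm-∷ l c) ⟩
    ∑ (suc ℓ) (λ k → cornerTerm c (x ∷ xs) (suc (suc k))) ∎

part-≤-maxPart : ∀ λ′ i → part λ′ i ≤ maxPart λ′
part-≤-maxPart []       i             = z≤n
part-≤-maxPart (x ∷ xs) zero          = z≤n
part-≤-maxPart (x ∷ xs) (suc zero)    = m≤m⊔n x (maxPart xs)
part-≤-maxPart (x ∷ xs) (suc (suc i)) = ≤-trans (part-≤-maxPart xs (suc i)) (m≤n⊔m x (maxPart xs))

headAtMost-upperPart : ∀ λ′ n p → HeadAtMost (maxPart λ′ ∸ p) (map (_∸ suc p) (take n λ′))
headAtMost-upperPart λ′       zero    p = just-nothing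
headAtMost-upperPart []       (suc n) p = just-nothing
headAtMost-upperPart (x ∷ xs) (suc n) p =
  just (≤-trans (∸-monoˡ-≤ (suc p) (m≤m⊔n x (maxPart xs))) (∸-monoʳ-≤ (x ⊔ maxPart xs) (n≤1+n p)))

cornerSum≋cornerSum≤ : ∀ λ′ → cornerSum λ′ ≋ cornerSum≤ (maxPart λ′) λ′
cornerSum≋cornerSum≤ λ′ = begin
  cornerSum λ′                                ≡⟨ sumOver-filterᵇ isCorner term (cellBox λ′) ⟩
  sumOver (cellBox λ′) F                      ≈⟨ sumOver-concatMap F row rows ⟩
  sumOver rows (λ i → sumOver (row i) F)      ≡⟨ sumOver-applyUpTo (λ i → sumOver (row i) F) suc (suc (length λ′)) ⟩
  ∑ (suc (length λ′)) (λ k → sumOver (row (suc k)) F)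
                                              ≈⟨ ∑-cong (suc (length λ′)) (λ k → rowSum (suc k)) ⟩
  cornerSum≤ m λ′                             ∎
  where
  open ≋-Reasoning
  m : ℕ
  m = maxPart λ′
  columns rows : List ℕ
  columns = applyUpTo suc (suc m)
  rows    = applyUpTo suc (suc (length λ′))
  row : ℕ → List (ℕ × ℕ)
  row i = map (i ,_) columns
  isCorner : ℕ × ℕ → Bool
  isCorner (i , j) = isOutsideCorner λ′ i j
  term : ℕ × ℕ → Poly
  term (i , j) = shift (i * (j ∸ 1)) (R (lowerPart λ′ i) ⊗ R (upperPart λ′ i j))
  F : ℕ × ℕ → Poly
  F x = if isCorner x then term x else []
  rowSum : ∀ i → sumOver (row i) F ≋ cornerTerm m λ′ i
  rowSum i = begin
    sumOver (row i) F                 ≡⟨ sumOver-map F (i ,_) columns ⟩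
    sumOver columns (F ∘ (i ,_))      ≡⟨ sumOver-applyUpTo (F ∘ (i ,_)) suc (suc m) ⟩
    ∑ (suc m) (λ t → F (i , suc t))   ≈⟨ ∑-select (suc m) p (λ t → (i ≡ᵇ 1) ∨ (suc t ≤ᵇ part λ′ (i ∸ 1)))
                                           (λ t → shift (i * t) (A ⊗ R (upperPart λ′ i (suc t))))
                                           (s≤s (part-≤-maxPart λ′ i)) ⟩
    (if cornerRowᵇ λ′ i then shift (i * p) (A ⊗ R U) else [])
                                      ≈⟨ if-cong (cornerRowᵇ λ′ i) (shift-cong (i * p) (⊗-congʳ A R≋R≤-upper)) ⟩
    (if cornerRowᵇ λ′ i then shift (i * p) (A ⊗ R≤ (m ∸ p) U) else [])
                                      ≡⟨ cong (λ b → if cornerRowᵇ λ′ i then (if b then shift (i * p) (A ⊗ R≤ (m ∸ p) U) else []) else [])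
                                              (sym (≤ᵇ-true (part-≤-maxPart λ′ i))) ⟩
    cornerTerm m λ′ i                 ∎
    where
    p : ℕ
    p = part λ′ i
    A : Poly
    A = R (lowerPart λ′ i)
    U : List ℕ
    U = upperPart λ′ i (suc p)
    R≋R≤-upper : R U ≋ R≤ (m ∸ p) U
    R≋R≤-upper = ≋-trans (R≋R≤ U) (≡⇒≋ (R≤-cap U (headAtMost-maxPart U) (headAtMost-upperPart λ′ (i ∸ 1) p)))

proposition1p5 : (λ′ : List ℕ) → IsPartition λ′ → R λ′ ≈ₚ cornerSum λ′
proposition1p5 λ′ (decreasing , _) = coeff-≡ (begin
  R λ′                       ≈⟨ R≋R≤ λ′ ⟩
  R≤ (maxPart λ′) λ′         ≈⟨ R≤≋cornerSum≤ λ′ decreasing (maxPart λ′) ⟩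
  cornerSum≤ (maxPart λ′) λ′ ≈⟨ ≋-sym (cornerSum≋cornerSum≤ λ′) ⟩
  cornerSum λ′               ∎)
  where open ≋-Reasoning
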